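{- Let $t$ be a positive integer and let $h_0,\ldots,h_{2t-1}$ be hash functions as described in the context, each evaluable in constant time. Consider the following procedure on input $A\subseteq[u]$: initialize an array $S$ of length $t$ with all entries $\infty$ and a counter $c\gets 0$; for $i=0,1,\ldots,2t-1$: for each $a\in A$, compute $(b,v)=h_i(a)$, if $S[b]=\infty$ set $c\gets c+1$, and set $S[b]\gets\min(S[b],v)$; after processing all $a\in A$ for this $i$, if $c=t$ return $S$. Then for every set $A\subseteq[u]$, the expected running time of this procedure is $O(t\log t+|A|)$.
   Context: $[n]=\{0,\ldots,n-1\}$. The hash functions $h_0,\ldots,h_{2t-1}$ are independent and fully random: for $i\in[t]$, $h_i:[u]\to[t]\times[i,i+1)$, $h_i(a)=(b_i(a),v_i(a))$ with $b_i(a)$ uniform on $[t]$ and $v_i(a)$ uniform on $[i,i+1)$; for $i\in\{t,\ldots,2t-1\}$, $h_i:[u]\to\{i-t\}\times[i,i+1)$, i.e. $b_i(a)=i-t$ and $v_i(a)$ uniform on $[i,i+1)$; all these values are mutually independent over keys and functions. -}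

module Defs where

open import Data.Nat using (ℕ; zero; suc; _+_; _*_; _≡ᵇ_)
open import Data.Bool using (Bool; true; false; if_then_else_)
open import Data.Fin using (Fin)
open import Data.Fin.Subset using (Subset; ∣_∣)
open import Data.Vec using (Vec; []; _∷_; lookup; replicate; _[_]≔_; toList)
open import Data.List using (List; []; _∷_; [_]; map; concatMap; allFin; filterᵇ; foldl; _++_; length)
open import Data.Product using (_×_; _,_)

-- All vectors of length n with entries from the list xs
-- (uniform distribution = uniform choice from this list).
allVecs : {A : Set} → (n : ℕ) → List A → List (Vec A n)
allVecs zero    xs = [ [] ]
allVecs (suc n) xs = concatMap (λ x → map (x ∷_) (allVecs n xs)) xs

-- A random outcome: the bucket components b_i(a) of h_0,…,h_{t-1}
-- on every key a ∈ [u]; outcome ! i ! a = b_i(a).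
Outcome : ℕ → ℕ → Set
Outcome t u = Vec (Vec (Fin t) u) t

-- All outcomes, each equally likely (fully random, independent hashing).
outcomes : (t u : ℕ) → List (Outcome t u)
outcomes t u = allVecs t (allVecs u (allFin t))

keys : {u : ℕ} → Subset u → List (Fin u)
keys {u} A = filterᵇ (lookup A) (allFin u)

-- State: which entries of S are ≠ ∞ (filled), and counter c.
State : ℕ → Set
State t = Vec Bool t × ℕ

step : {t u : ℕ} → (Fin u → Fin t) → State t → Fin u → State t
step b (S , c) a =
  if lookup S (b a) then (S , c) else ((S [ b a ]≔ true) , suc c)

-- Bucket functions b_0,…,b_{2t-1} in order:
-- b_i = outcome ! i for i < t, and b_i(a) = i - t for t ≤ i < 2t.
buckets : {t u : ℕ} → Outcome t u → List (Fin u → Fin t)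
buckets {t} o = map (λ row a → lookup row a) (toList o)
             ++ map (λ j _ → j) (allFin t)

-- Running time of the rounds: each round costs |A| + 1
-- (|A| constant-time key operations plus the test c = t);
-- stop as soon as c = t after a round.
runRounds : {t u : ℕ} → Subset u → List (Fin u → Fin t) → State t → ℕ
runRounds A [] st = 0
runRounds {t} A (b ∷ bs) st with foldl (step b) st (keys A)
... | (S' , c') = (∣ A ∣ + 1) + (if c' ≡ᵇ t then 0 else runRounds A bs (S' , c'))

-- Total running time: t for initializing S (plus 1 for c) plus the rounds.
runningTime : (t u : ℕ) → Subset u → Outcome t u → ℕ
runningTime t u A o = (t + 1) + runRounds A (buckets o) (replicate t false , 0)

-- Each of the first t rounds throws the |A| keys into independent uniform buckets, and the last t
-- rounds fill the buckets one by one, so the procedure stops within 2t rounds, each costing |A| + 1.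
-- Round r + 1 runs only if a bucket is still empty after r rounds, which by the union bound has
-- probability at most min(1, t (1 − 1/t)^(r |A|)). Grouping the terms in blocks of |A|,
-- |A| · Σ_{1 ≤ r ≤ t} min(1, t (1 − 1/t)^(r |A|)) ≤ Σ_{x < t |A|} min(1, t (1 − 1/t)^x) ≤ t L + t with
-- L = ⌈log₂ t⌉: the first t L terms are at most 1 and the rest form a geometric series starting
-- at t (1 − 1/t)^(t L) ≤ t 2^(−L) ≤ 1. The deterministic rounds are reached with probability at
-- most t (1 − 1/t)^(t |A|) ≤ 2^(L − |A|), which contributes O(t L) as well. Probabilities are
-- counted over the finite list of outcomes, with every estimate multiplied by a power of t.

module Submission where

open import Defs
open import Data.Nat using (ℕ; _+_; _*_; _≤_)
open import Data.Nat.Logarithm using (⌈log₂_⌉)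
open import Data.Fin.Subset using (Subset; ∣_∣)
open import Data.List using (map; length)
open import Data.Nat.ListAction using (sum)
open import Data.Product using (∃-syntax)

open import Data.Bool using (Bool; true; false; if_then_else_; T)
open import Data.Fin as F using (Fin; zero; suc)
open import Data.List using (List; []; _∷_; _++_; foldl; take; allFin; concatMap; tabulate)
open import Data.List.Membership.Propositional using (_∈_)
open import Data.List.Membership.Propositional.Properties using (∈-allFin; ∈-filter⁺)
open import Data.List.Properties using (length-map; length-tabulate; take-all; map-++; map-∘; map-tabulate)
open import Data.List.Relation.Unary.Any using (here; there)
open import Data.Nat
open import Data.Nat.ListAction.Properties using (sum-++)
open import Data.Nat.Logarithm.Core using (⌈log2⌉)
open import Data.Nat.Properties
open import Data.Nat.Tactic.RingSolver using (solve-∀)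
open import Data.Product using (_×_; _,_; proj₁; proj₂; ∃)
open import Data.Unit using (tt)
open import Data.Vec using (Vec; []; _∷_; lookup; replicate; toList; _[_]≔_)
open import Data.Vec.Properties using (lookup∘update; lookup∘update′; length-toList)
open import Function using (_∘_)
open import Induction.WellFounded using (Acc; acc)
open import Relation.Binary.PropositionalEquality
open import Relation.Nullary using (yes; no; contradiction)
open import Relation.Nullary.Decidable using (T?)

^-distribʳ-* : ∀ m n o → (m * n) ^ o ≡ m ^ o * n ^ o
^-distribʳ-* m n zero    = refl
^-distribʳ-* m n (suc o) = trans (cong (m * n *_) (^-distribʳ-* m n o)) (regroup m n (m ^ o) (n ^ o))
  where
  regroup : ∀ a b c d → a * b * (c * d) ≡ a * c * (b * d)
  regroup = solve-∀

n≤2^⌈log2⌉n : ∀ n (rec : Acc _<_ n) → n ≤ 2 ^ ⌈log2⌉ n rec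
n≤2^⌈log2⌉n zero          _        = z≤n
n≤2^⌈log2⌉n (suc zero)    _        = s≤s z≤n
n≤2^⌈log2⌉n (suc (suc n)) (acc rs) = begin
  2 + n                          ≡⟨ cong (2 +_) (⌊n/2⌋+⌈n/2⌉≡n n) ⟨
  2 + (⌊ n /2⌋ + ⌈ n /2⌉)         ≤⟨ +-monoʳ-≤ 2 (+-monoˡ-≤ ⌈ n /2⌉ (⌊n/2⌋≤⌈n/2⌉ n)) ⟩
  2 + (⌈ n /2⌉ + ⌈ n /2⌉)         ≡⟨ double ⌈ n /2⌉ ⟩
  2 * suc ⌈ n /2⌉                ≤⟨ *-monoʳ-≤ 2 (n≤2^⌈log2⌉n (suc ⌈ n /2⌉) _) ⟩
  2 * 2 ^ ⌈log2⌉ (suc ⌈ n /2⌉) _ ∎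
  where
  open ≤-Reasoning
  double : ∀ x → 2 + (x + x) ≡ 2 * suc x
  double = solve-∀

n≤2^⌈log₂n⌉ : ∀ n → n ≤ 2 ^ ⌈log₂ n ⌉
n≤2^⌈log₂n⌉ n = n≤2^⌈log2⌉n n _

-- (1 + 1/a)ⁿ ≥ 1 + n/a with the denominators cleared.
bernoulli : ∀ a n → a ^ n * (a + n) ≤ suc a ^ n * a
bernoulli a zero    = ≤-reflexive (cong (_+ 0) (+-identityʳ a))
bernoulli a (suc n) = begin
  a * a ^ n * (a + suc n)             ≡⟨ split (a ^ n) a n ⟩
  a * (a ^ n * (a + n)) + a ^ n * a   ≤⟨ +-mono-≤ (*-monoʳ-≤ a (bernoulli a n))
                                                  (*-monoˡ-≤ a (^-monoˡ-≤ n (n≤1+n a))) ⟩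
  a * (suc a ^ n * a) + suc a ^ n * a ≡⟨ merge (suc a ^ n) a ⟩
  suc a * suc a ^ n * a               ∎
  where
  open ≤-Reasoning
  split : ∀ x a n → a * x * (a + suc n) ≡ a * (x * (a + n)) + x * a
  split = solve-∀
  merge : ∀ y a → a * (y * a) + y * a ≡ suc a * y * a
  merge = solve-∀

2*n^[1+n]≤[1+n]^[1+n] : ∀ n → 2 * n ^ suc n ≤ suc n ^ suc n
2*n^[1+n]≤[1+n]^[1+n] zero      = z≤n
2*n^[1+n]≤[1+n]^[1+n] n@(suc _) = *-cancelˡ-≤ n (begin
  n * (2 * n ^ suc n)     ≡⟨ regroup (n ^ suc n) n ⟩
  n ^ suc n * (n + n)     ≤⟨ *-monoʳ-≤ (n ^ suc n) (+-monoʳ-≤ n (n≤1+n n)) ⟩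
  n ^ suc n * (n + suc n) ≤⟨ bernoulli n (suc n) ⟩
  suc n ^ suc n * n       ≡⟨ *-comm (suc n ^ suc n) n ⟩
  n * suc n ^ suc n       ∎)
  where
  open ≤-Reasoning
  regroup : ∀ x n → n * (2 * x) ≡ x * (n + n)
  regroup = solve-∀

-- (1 − 1/t)^(t m) ≤ 2^(−m) for t = n + 1.
2^m*n^[[1+n]*m]≤[1+n]^[[1+n]*m] : ∀ n m → 2 ^ m * n ^ (suc n * m) ≤ suc n ^ (suc n * m)
2^m*n^[[1+n]*m]≤[1+n]^[[1+n]*m] n zero    rewrite *-zeroʳ n = ≤-refl
2^m*n^[[1+n]*m]≤[1+n]^[[1+n]*m] n (suc m) = begin
  2 * 2 ^ m * n ^ (suc n * suc m)               ≡⟨ cong (2 * 2 ^ m *_) (power n) ⟩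
  2 * 2 ^ m * (n ^ suc n * n ^ (suc n * m))     ≡⟨ regroup 2 (2 ^ m) (n ^ suc n) (n ^ (suc n * m)) ⟩
  2 * n ^ suc n * (2 ^ m * n ^ (suc n * m))     ≤⟨ *-mono-≤ (2*n^[1+n]≤[1+n]^[1+n] n)
                                                            (2^m*n^[[1+n]*m]≤[1+n]^[[1+n]*m] n m) ⟩
  suc n ^ suc n * suc n ^ (suc n * m)           ≡⟨ power (suc n) ⟨
  suc n ^ (suc n * suc m)                       ∎
  where
  open ≤-Reasoning
  power : ∀ a → a ^ (suc n * suc m) ≡ a ^ suc n * a ^ (suc n * m)
  power a = trans (cong (a ^_) (*-suc (suc n) m)) (^-distribˡ-+-* a (suc n) (suc n * m))
  regroup : ∀ a b c d → a * b * (c * d) ≡ a * c * (b * d)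
  regroup = solve-∀

1+n≤2^n : ∀ n → suc n ≤ 2 ^ n
1+n≤2^n zero    = s≤s z≤n
1+n≤2^n (suc n) = +-mono-≤ (≤-trans (s≤s z≤n) (1+n≤2^n n)) (≤-trans (1+n≤2^n n) (m≤m+n (2 ^ n) 0))

[1+n]*2^m≤[1+m]*2^n : ∀ {m n} → m ≤ n → suc n * 2 ^ m ≤ suc m * 2 ^ n
[1+n]*2^m≤[1+m]*2^n {m} m≤n with m≤n⇒∃[o]m+o≡n m≤n
... | d , refl = begin
  suc (m + d) * 2 ^ m         ≤⟨ *-monoˡ-≤ (2 ^ m) (≤-trans (m≤m+n _ (m * d)) (≤-reflexive (expand m d))) ⟩
  suc m * suc d * 2 ^ m       ≤⟨ *-monoˡ-≤ (2 ^ m) (*-monoʳ-≤ (suc m) (1+n≤2^n d)) ⟩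
  suc m * 2 ^ d * 2 ^ m       ≡⟨ regroup (suc m) (2 ^ d) (2 ^ m) ⟩
  suc m * (2 ^ m * 2 ^ d)     ≡⟨ cong (suc m *_) (^-distribˡ-+-* 2 m d) ⟨
  suc m * 2 ^ (m + d)         ∎
  where
  open ≤-Reasoning
  expand : ∀ m d → suc (m + d) + m * d ≡ suc m * suc d
  expand = solve-∀
  regroup : ∀ a b c → a * b * c ≡ a * (c * b)
  regroup = solve-∀

n≤n*m+1 : ∀ n m → n ≤ 2 ^ m → n ≤ n * m + 1
n≤n*m+1 n zero    n≤1 = ≤-trans n≤1 (≤-reflexive (cong (_+ 1) (sym (*-zeroʳ n))))
n≤n*m+1 n (suc m) _   = ≤-trans (m≤m*n n (suc m)) (m≤m+n (n * suc m) 1)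

a^y*b^[n∸y]≤a^x*b^[n∸x] : ∀ {a b x y n} → a ≤ b → x ≤ y → y ≤ n →
                          a ^ y * b ^ (n ∸ y) ≤ a ^ x * b ^ (n ∸ x)
a^y*b^[n∸y]≤a^x*b^[n∸x] {a} {b} {x} a≤b x≤y y≤n with m≤n⇒∃[o]m+o≡n x≤y
... | d , refl with m≤n⇒∃[o]m+o≡n y≤n
... | e , refl = begin
  a ^ (x + d) * b ^ (x + d + e ∸ (x + d)) ≡⟨ cong₂ _*_ (^-distribˡ-+-* a x d) (cong (b ^_) (m+n∸m≡n (x + d) e)) ⟩
  a ^ x * a ^ d * b ^ e                   ≤⟨ *-monoˡ-≤ (b ^ e) (*-monoʳ-≤ (a ^ x) (^-monoˡ-≤ d a≤b)) ⟩
  a ^ x * b ^ d * b ^ e                   ≡⟨ *-assoc (a ^ x) (b ^ d) (b ^ e) ⟩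
  a ^ x * (b ^ d * b ^ e)                 ≡⟨ cong (a ^ x *_) (^-distribˡ-+-* b d e) ⟨
  a ^ x * b ^ (d + e)                     ≡⟨ cong (λ z → a ^ x * b ^ z) exponent ⟩
  a ^ x * b ^ (x + d + e ∸ x)             ∎
  where
  open ≤-Reasoning
  exponent : d + e ≡ x + d + e ∸ x
  exponent = trans (sym (m+n∸m≡n x (d + e))) (cong (_∸ x) (sym (+-assoc x d e)))

∑< : ℕ → (ℕ → ℕ) → ℕ
∑< zero    f = 0
∑< (suc n) f = f 0 + ∑< n (λ i → f (suc i))

infix 5 ∑<
syntax ∑< n (λ i → e) = ∑[ i < n ] e

∑<-cong : ∀ n {f g : ℕ → ℕ} → (∀ i → f i ≡ g i) → ∑< n f ≡ ∑< n g
∑<-cong zero    f≗g = refl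
∑<-cong (suc n) f≗g = cong₂ _+_ (f≗g 0) (∑<-cong n (λ i → f≗g (suc i)))

∑<-mono-≤ : ∀ n {f g : ℕ → ℕ} → (∀ i → i < n → f i ≤ g i) → ∑< n f ≤ ∑< n g
∑<-mono-≤ zero    f≤g = z≤n
∑<-mono-≤ (suc n) f≤g = +-mono-≤ (f≤g 0 z<s) (∑<-mono-≤ n (λ i i<n → f≤g (suc i) (s<s i<n)))

∑<≤n*c : ∀ n {f : ℕ → ℕ} c → (∀ i → i < n → f i ≤ c) → ∑< n f ≤ n * c
∑<≤n*c zero    c f≤c = z≤n
∑<≤n*c (suc n) c f≤c = +-mono-≤ (f≤c 0 z<s) (∑<≤n*c n c (λ i i<n → f≤c (suc i) (s<s i<n)))

n*c≤∑< : ∀ n {f : ℕ → ℕ} c → (∀ i → i < n → c ≤ f i) → n * c ≤ ∑< n f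
n*c≤∑< zero    c c≤f = z≤n
n*c≤∑< (suc n) c c≤f = +-mono-≤ (c≤f 0 z<s) (n*c≤∑< n c (λ i i<n → c≤f (suc i) (s<s i<n)))

∑<-split : ∀ m n (f : ℕ → ℕ) → ∑< (m + n) f ≡ ∑< m f + (∑[ i < n ] f (m + i))
∑<-split zero    n f = refl
∑<-split (suc m) n f = trans (cong (f 0 +_) (∑<-split m n (λ i → f (suc i))))
                             (sym (+-assoc (f 0) _ _))

*-distribˡ-∑< : ∀ n c (f : ℕ → ℕ) → c * ∑< n f ≡ ∑[ i < n ] c * f i
*-distribˡ-∑< zero    c f = *-zeroʳ c
*-distribˡ-∑< (suc n) c f = trans (*-distribˡ-+ c (f 0) _) (cong (c * f 0 +_) (*-distribˡ-∑< n c (λ i → f (suc i))))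

∑<-blocks : ∀ n k (f : ℕ → ℕ) → ∑< (n * k) f ≡ ∑[ r < n ] ∑[ i < k ] f (r * k + i)
∑<-blocks zero    k f = refl
∑<-blocks (suc n) k f = begin
  ∑< (k + n * k) f                                          ≡⟨ ∑<-split k (n * k) f ⟩
  ∑< k f + (∑[ i < n * k ] f (k + i))
    ≡⟨ cong (∑< k f +_) (∑<-blocks n k (λ i → f (k + i))) ⟩
  ∑< k f + (∑[ r < n ] ∑[ i < k ] f (k + (r * k + i)))
    ≡⟨ cong (∑< k f +_) (∑<-cong n (λ r → ∑<-cong k (λ i → cong f (sym (+-assoc k (r * k) i))))) ⟩
  ∑< k f + (∑[ r < n ] ∑[ i < k ] f (suc r * k + i)) ∎
  where open ≡-Reasoning

∑<-geometric : ∀ P d → (∑[ y < d ] P ^ y * suc P ^ (d ∸ y)) + suc P * P ^ d ≡ suc P ^ suc d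
∑<-geometric P zero    = refl
∑<-geometric P (suc d) = begin
  1 * suc P ^ suc d + (∑[ y < d ] P * P ^ y * suc P ^ (d ∸ y)) + suc P * (P * P ^ d)
      ≡⟨ cong (λ s → 1 * suc P ^ suc d + s + suc P * (P * P ^ d))
              (trans (∑<-cong d (λ y → *-assoc P (P ^ y) _)) (sym (*-distribˡ-∑< d P _))) ⟩
  1 * suc P ^ suc d + P * g + suc P * (P * P ^ d) ≡⟨ regroup (suc P ^ suc d) g (P ^ d) P ⟩
  suc P ^ suc d + P * (g + suc P * P ^ d)      ≡⟨ cong (λ s → suc P ^ suc d + P * s) (∑<-geometric P d) ⟩
  suc P ^ suc d + P * suc P ^ suc d            ∎
  where
  open ≡-Reasoning
  g = ∑[ y < d ] P ^ y * suc P ^ (d ∸ y)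
  regroup : ∀ a g q P → 1 * a + P * g + suc P * (P * q) ≡ a + P * (g + suc P * q)
  regroup = solve-∀

-- Σ_{x < n} min(1, t (1 − 1/t)^x) ≤ t L + t for t = P + 1 ≤ 2^L, multiplied by tⁿ.
∑<-min-geometric : ∀ P L n → suc P ≤ 2 ^ L →
  (∑[ x < n ] (suc P ^ n ⊓ (suc P * (P ^ x * suc P ^ (n ∸ x))))) ≤ (suc P * L + suc P) * suc P ^ n
∑<-min-geometric P L n t≤2^L with n ≤? suc P * L
... | yes n≤tL = ≤-trans (∑<≤n*c n (suc P ^ n) (λ _ _ → m⊓n≤m _ _))
                         (*-monoˡ-≤ (suc P ^ n) (≤-trans n≤tL (m≤m+n _ (suc P))))
... | no n≰tL with m≤n⇒∃[o]m+o≡n (≰⇒≥ n≰tL)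
... | d , refl = begin
  ∑< (tL + d) term                                  ≡⟨ ∑<-split tL d term ⟩
  ∑< tL term + (∑[ y < d ] term (tL + y))
    ≤⟨ +-mono-≤ (∑<≤n*c tL (t ^ (tL + d)) (λ _ _ → m⊓n≤m _ _)) tail ⟩
  tL * t ^ (tL + d) + t * t ^ (tL + d)              ≡⟨ *-distribʳ-+ (t ^ (tL + d)) tL t ⟨
  (tL + t) * t ^ (tL + d)                           ∎
  where
  open ≤-Reasoning
  t = suc P
  tL = t * L
  term : ℕ → ℕ
  term x = t ^ (tL + d) ⊓ (t * (P ^ x * t ^ (tL + d ∸ x)))
  c = t * P ^ tL
  c≤t^tL : c ≤ t ^ tL
  c≤t^tL = ≤-trans (*-monoˡ-≤ (P ^ tL) t≤2^L) (2^m*n^[[1+n]*m]≤[1+n]^[[1+n]*m] P L)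
  term≤ : ∀ y → term (tL + y) ≤ c * (P ^ y * t ^ (d ∸ y))
  term≤ y = ≤-trans (m⊓n≤n _ _) (≤-reflexive (begin-equality
    t * (P ^ (tL + y) * t ^ (tL + d ∸ (tL + y))) ≡⟨ cong₂ (λ a b → t * (a * t ^ b)) (^-distribˡ-+-* P tL y)
                                                           ([m+n]∸[m+o]≡n∸o tL d y) ⟩
    t * (P ^ tL * P ^ y * t ^ (d ∸ y))           ≡⟨ regroup t (P ^ tL) (P ^ y) (t ^ (d ∸ y)) ⟩
    c * (P ^ y * t ^ (d ∸ y))                    ∎))
    where
    regroup : ∀ a b c d → a * (b * c * d) ≡ a * b * (c * d)
    regroup = solve-∀
  geometric≤ : (∑[ y < d ] P ^ y * t ^ (d ∸ y)) ≤ t * t ^ d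
  geometric≤ = ≤-trans (m≤m+n _ (t * P ^ d)) (≤-reflexive (∑<-geometric P d))
  tail : (∑[ y < d ] term (tL + y)) ≤ t * t ^ (tL + d)
  tail = begin
    ∑[ y < d ] term (tL + y)                 ≤⟨ ∑<-mono-≤ d (λ y _ → term≤ y) ⟩
    ∑[ y < d ] c * (P ^ y * t ^ (d ∸ y))     ≡⟨ *-distribˡ-∑< d c _ ⟨
    c * (∑[ y < d ] P ^ y * t ^ (d ∸ y))     ≤⟨ *-mono-≤ c≤t^tL geometric≤ ⟩
    t ^ tL * (t * t ^ d)                     ≡⟨ regroup (t ^ tL) t (t ^ d) ⟩
    t * (t ^ tL * t ^ d)                     ≡⟨ cong (t *_) (^-distribˡ-+-* t tL d) ⟨
    t * t ^ (tL + d)                         ∎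
    where
    regroup : ∀ a b c → a * (b * c) ≡ b * (a * c)
    regroup = solve-∀

-- Y r / N is the probability that a bucket is still empty after r random rounds, and Y-decay is
-- the union bound t (1 − 1/t)^(r k) for it.
module PendingRounds (P L k N : ℕ) (Y : ℕ → ℕ)
  (t≤2^L : suc P ≤ 2 ^ L)
  (Y≤N : ∀ r → Y r ≤ N)
  (Y-decay : ∀ r → r ≤ suc P → Y r * suc P ^ (r * k) ≤ suc P * N * P ^ (r * k)) where

  private
    t = suc P
    X = t * k

    instance
      t^X≢0 : NonZero (t ^ X)
      t^X≢0 = m^n≢0 t X

  -- t^X · min(1, t (1 − 1/t)^x)
  truncated : ℕ → ℕ
  truncated x = t ^ X ⊓ (t * (P ^ x * t ^ (X ∸ x)))

  Y*t^X≤N*truncated : ∀ r i → r < t → i < k → Y (suc r) * t ^ X ≤ N * truncated (r * k + i)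
  Y*t^X≤N*truncated r i r<t i<k = ≤-trans (⊓-glb (*-monoˡ-≤ (t ^ X) (Y≤N (suc r))) decayed)
                                          (≤-reflexive (sym (*-distribˡ-⊓ N _ _)))
    where
    open ≤-Reasoning
    e = suc r * k
    e≤X : e ≤ X
    e≤X = *-monoˡ-≤ k r<t
    decayed : Y (suc r) * t ^ X ≤ N * (t * (P ^ (r * k + i) * t ^ (X ∸ (r * k + i))))
    decayed = begin
      Y (suc r) * t ^ X                          ≡⟨ cong (λ z → Y (suc r) * t ^ z) (m+[n∸m]≡n e≤X) ⟨
      Y (suc r) * t ^ (e + (X ∸ e))              ≡⟨ cong (Y (suc r) *_) (^-distribˡ-+-* t e (X ∸ e)) ⟩
      Y (suc r) * (t ^ e * t ^ (X ∸ e))          ≡⟨ *-assoc (Y (suc r)) (t ^ e) _ ⟨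
      Y (suc r) * t ^ e * t ^ (X ∸ e)            ≤⟨ *-monoˡ-≤ (t ^ (X ∸ e)) (Y-decay (suc r) r<t) ⟩
      t * N * P ^ e * t ^ (X ∸ e)                ≡⟨ regroup t N (P ^ e) (t ^ (X ∸ e)) ⟩
      N * (t * (P ^ e * t ^ (X ∸ e)))            ≤⟨ *-monoʳ-≤ N (*-monoʳ-≤ t
                                                     (a^y*b^[n∸y]≤a^x*b^[n∸x] (n≤1+n P) rk+i≤e e≤X)) ⟩
      N * (t * (P ^ (r * k + i) * t ^ (X ∸ (r * k + i)))) ∎
      where
      rk+i≤e : r * k + i ≤ e
      rk+i≤e = ≤-trans (+-monoʳ-≤ (r * k) (<⇒≤ i<k)) (≤-reflexive (+-comm (r * k) k))
      regroup : ∀ a b c d → a * b * c * d ≡ b * (a * (c * d))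
      regroup = solve-∀

  ∑Y = ∑[ r < t ] Y (suc r)

  k*∑Y≤[t*L+t]*N : k * ∑Y ≤ (t * L + t) * N
  k*∑Y≤[t*L+t]*N = *-cancelˡ-≤ (t ^ X) (begin
    t ^ X * (k * ∑Y)                               ≡⟨ regroup (t ^ X) k ∑Y ⟩
    k * (t ^ X * ∑Y)                               ≡⟨ cong (k *_) (*-distribˡ-∑< t (t ^ X) (λ r → Y (suc r))) ⟩
    k * (∑[ r < t ] t ^ X * Y (suc r))              ≡⟨ *-distribˡ-∑< t k (λ r → t ^ X * Y (suc r)) ⟩
    ∑[ r < t ] k * (t ^ X * Y (suc r))              ≤⟨ ∑<-mono-≤ t (λ r r<t → n*c≤∑< k _ (λ i i<k →
                                                        ≤-trans (≤-reflexive (*-comm (t ^ X) (Y (suc r))))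
                                                                (Y*t^X≤N*truncated r i r<t i<k))) ⟩
    ∑[ r < t ] ∑[ i < k ] N * truncated (r * k + i) ≡⟨ ∑<-blocks t k (λ x → N * truncated x) ⟨
    ∑[ x < X ] N * truncated x                      ≡⟨ *-distribˡ-∑< X N truncated ⟨
    N * (∑[ x < X ] truncated x)                    ≤⟨ *-monoʳ-≤ N (∑<-min-geometric P L X t≤2^L) ⟩
    N * ((t * L + t) * t ^ X)                       ≡⟨ regroup′ N (t * L + t) (t ^ X) ⟩
    t ^ X * ((t * L + t) * N)                       ∎)
    where
    open ≤-Reasoning
    regroup : ∀ a b c → a * (b * c) ≡ b * (a * c)
    regroup = solve-∀
    regroup′ : ∀ a b c → a * (b * c) ≡ c * (b * a)
    regroup′ = solve-∀

  [1+k]*Y[t]≤[1+L]*N : suc k * Y t ≤ suc L * N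
  [1+k]*Y[t]≤[1+L]*N with k ≤? L
  ... | yes k≤L = *-mono-≤ (s≤s k≤L) (Y≤N t)
  ... | no k≰L  = *-cancelˡ-≤ (t ^ X) (begin
    t ^ X * (suc k * Y t)              ≡⟨ regroup (t ^ X) (suc k) (Y t) ⟩
    suc k * (Y t * t ^ X)              ≤⟨ *-monoʳ-≤ (suc k) (Y-decay t ≤-refl) ⟩
    suc k * (t * N * P ^ X)            ≡⟨ regroup′ (suc k) t N (P ^ X) ⟩
    N * (suc k * t * P ^ X)            ≤⟨ *-monoʳ-≤ N (*-monoˡ-≤ (P ^ X) (*-monoʳ-≤ (suc k) t≤2^L)) ⟩
    N * (suc k * 2 ^ L * P ^ X)        ≤⟨ *-monoʳ-≤ N (*-monoˡ-≤ (P ^ X) ([1+n]*2^m≤[1+m]*2^n (≰⇒≥ k≰L))) ⟩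
    N * (suc L * 2 ^ k * P ^ X)        ≡⟨ cong (N *_) (*-assoc (suc L) (2 ^ k) (P ^ X)) ⟩
    N * (suc L * (2 ^ k * P ^ X))      ≤⟨ *-monoʳ-≤ N (*-monoʳ-≤ (suc L) (2^m*n^[[1+n]*m]≤[1+n]^[[1+n]*m] P k)) ⟩
    N * (suc L * t ^ (t * k))          ≡⟨ regroup″ N (suc L) (t ^ X) ⟩
    t ^ X * (suc L * N)                ∎)
    where
    open ≤-Reasoning
    regroup : ∀ a b c → a * (b * c) ≡ b * (c * a)
    regroup = solve-∀
    regroup′ : ∀ a b c d → a * (b * c * d) ≡ c * (a * b * d)
    regroup′ = solve-∀
    regroup″ : ∀ a b c → a * (b * c) ≡ c * (b * a)
    regroup″ = solve-∀

  rounds-bound : (t + 1) * N + (k + 1) * (N + ∑Y + t * Y t) ≤ 6 * (t * L + k + 1) * N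
  rounds-bound = begin
    (t + 1) * N + (k + 1) * (N + ∑Y + t * Y t)                              ≡⟨ expand t k N ∑Y (Y t) ⟩
    (t + 1) * N + (k + 1) * N + ∑Y + k * ∑Y + t * (suc k * Y t)
      ≤⟨ +-mono-≤ (+-mono-≤ (+-monoʳ-≤ ((t + 1) * N + (k + 1) * N) ∑Y≤t*N) k*∑Y≤[t*L+t]*N)
                  (*-monoʳ-≤ t [1+k]*Y[t]≤[1+L]*N) ⟩
    (t + 1) * N + (k + 1) * N + t * N + (t * L + t) * N + t * (suc L * N) ≡⟨ collect t k L N ⟩
    (4 * t + 2 * (t * L) + k + 2) * N                                       ≤⟨ *-monoˡ-≤ N coefficient ⟩
    6 * (t * L + k + 1) * N                                                 ∎
    where
    open ≤-Reasoning
    ∑Y≤t*N : ∑Y ≤ t * N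
    ∑Y≤t*N = ∑<≤n*c t N (λ r _ → Y≤N (suc r))
    expand : ∀ t k N S y → (t + 1) * N + (k + 1) * (N + S + t * y)
                         ≡ (t + 1) * N + (k + 1) * N + S + k * S + t * ((1 + k) * y)
    expand = solve-∀
    collect : ∀ t k L N → (t + 1) * N + (k + 1) * N + t * N + (t * L + t) * N + t * ((1 + L) * N)
                        ≡ (4 * t + 2 * (t * L) + k + 2) * N
    collect = solve-∀
    slack : ∀ a k → 4 * (a + 1) + 2 * a + k + 2 + 5 * k ≡ 6 * (a + k + 1)
    slack = solve-∀
    coefficient : 4 * t + 2 * (t * L) + k + 2 ≤ 6 * (t * L + k + 1)
    coefficient = begin
      4 * t + 2 * (t * L) + k + 2              ≤⟨ +-monoˡ-≤ 2 (+-monoˡ-≤ k (+-monoˡ-≤ (2 * (t * L))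
                                                    (*-monoʳ-≤ 4 (n≤n*m+1 t L t≤2^L)))) ⟩
      4 * (t * L + 1) + 2 * (t * L) + k + 2    ≤⟨ m≤m+n _ (5 * k) ⟩
      4 * (t * L + 1) + 2 * (t * L) + k + 2 + 5 * k ≡⟨ slack (t * L) k ⟩
      6 * (t * L + k + 1)                      ∎

sum-map-mono-≤ : ∀ {A : Set} {f g : A → ℕ} (xs : List A) → (∀ x → f x ≤ g x) → sum (map f xs) ≤ sum (map g xs)
sum-map-mono-≤ []       f≤g = z≤n
sum-map-mono-≤ (x ∷ xs) f≤g = +-mono-≤ (f≤g x) (sum-map-mono-≤ xs f≤g)

∈⇒≤sum-map : ∀ {A : Set} (f : A → ℕ) {x : A} {xs : List A} → x ∈ xs → f x ≤ sum (map f xs)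
∈⇒≤sum-map f (here refl)                = m≤m+n _ _
∈⇒≤sum-map f {xs = y ∷ xs} (there x∈xs) = ≤-trans (∈⇒≤sum-map f x∈xs) (m≤n+m _ (f y))

sum-map-cong : ∀ {A : Set} {f g : A → ℕ} (xs : List A) → (∀ x → f x ≡ g x) → sum (map f xs) ≡ sum (map g xs)
sum-map-cong []       f≗g = refl
sum-map-cong (x ∷ xs) f≗g = cong₂ _+_ (f≗g x) (sum-map-cong xs f≗g)

sum-map-const : ∀ {A : Set} c (xs : List A) → sum (map (λ _ → c) xs) ≡ c * length xs
sum-map-const c []       = sym (*-zeroʳ c)
sum-map-const c (x ∷ xs) = trans (cong (c +_) (sum-map-const c xs)) (sym (*-suc c (length xs)))

sum-map-+ : ∀ {A : Set} (f g : A → ℕ) (xs : List A) →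
            sum (map (λ x → f x + g x) xs) ≡ sum (map f xs) + sum (map g xs)
sum-map-+ f g []       = refl
sum-map-+ f g (x ∷ xs) = trans (cong (f x + g x +_) (sum-map-+ f g xs)) (regroup (f x) (g x) _ _)
  where
  regroup : ∀ a b c d → a + b + (c + d) ≡ a + c + (b + d)
  regroup = solve-∀

*-distribˡ-sum-map : ∀ {A : Set} c (f : A → ℕ) (xs : List A) → c * sum (map f xs) ≡ sum (map (λ x → c * f x) xs)
*-distribˡ-sum-map c f []       = *-zeroʳ c
*-distribˡ-sum-map c f (x ∷ xs) = trans (*-distribˡ-+ c (f x) _) (cong (c * f x +_) (*-distribˡ-sum-map c f xs))

*-distribʳ-sum-map : ∀ {A : Set} c (f : A → ℕ) (xs : List A) → sum (map f xs) * c ≡ sum (map (λ x → f x * c) xs)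
*-distribʳ-sum-map c f []       = refl
*-distribʳ-sum-map c f (x ∷ xs) = trans (*-distribʳ-+ c (f x) _) (cong (f x * c +_) (*-distribʳ-sum-map c f xs))

sum-map-comm : ∀ {A B : Set} (F : A → B → ℕ) (xs : List A) (ys : List B) →
  sum (map (λ x → sum (map (F x) ys)) xs) ≡ sum (map (λ y → sum (map (λ x → F x y) xs)) ys)
sum-map-comm F []       ys = sym (trans (sum-map-const 0 ys) (*-zeroˡ (length ys)))
sum-map-comm F (x ∷ xs) ys = trans (cong (sum (map (F x) ys) +_) (sum-map-comm F xs ys))
                                   (sym (sum-map-+ (F x) (λ y → sum (map (λ x → F x y) xs)) ys))

sum-map-∑< : ∀ {A : Set} n (F : ℕ → A → ℕ) (xs : List A) →
  sum (map (λ x → ∑[ r < n ] F r x) xs) ≡ ∑[ r < n ] sum (map (F r) xs)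
sum-map-∑< zero    F xs = trans (sum-map-const 0 xs) (*-zeroˡ (length xs))
sum-map-∑< (suc n) F xs = trans (sum-map-+ (F 0) (λ x → ∑[ r < n ] F (suc r) x) xs)
                                (cong (sum (map (F 0) xs) +_) (sum-map-∑< n (λ r → F (suc r)) xs))

sum-map-concatMap : ∀ {A B : Set} (f : B → ℕ) (g : A → List B) (xs : List A) →
  sum (map f (concatMap g xs)) ≡ sum (map (λ x → sum (map f (g x))) xs)
sum-map-concatMap f g []       = refl
sum-map-concatMap f g (x ∷ xs) = begin
  sum (map f (g x ++ concatMap g xs))              ≡⟨ cong sum (map-++ f (g x) (concatMap g xs)) ⟩
  sum (map f (g x) ++ map f (concatMap g xs))      ≡⟨ sum-++ (map f (g x)) _ ⟩
  sum (map f (g x)) + sum (map f (concatMap g xs)) ≡⟨ cong (sum (map f (g x)) +_) (sum-map-concatMap f g xs) ⟩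
  sum (map f (g x)) + sum (map (λ x → sum (map f (g x))) xs) ∎
  where open ≡-Reasoning

length≡sum-map-1 : ∀ {A : Set} (xs : List A) → length xs ≡ sum (map (λ _ → 1) xs)
length≡sum-map-1 xs = sym (trans (sum-map-const 1 xs) (*-identityˡ (length xs)))

length-allFin : ∀ n → length (allFin n) ≡ n
length-allFin n = length-tabulate (λ i → i)

-- The procedure

∣p[i]≔true∣ : ∀ {n} (p : Subset n) (i : Fin n) → lookup p i ≡ false → ∣ p [ i ]≔ true ∣ ≡ suc ∣ p ∣
∣p[i]≔true∣ (false ∷ p) zero    _        = refl
∣p[i]≔true∣ (true ∷ p)  (suc i) p[i]≡false = cong suc (∣p[i]≔true∣ p i p[i]≡false)
∣p[i]≔true∣ (false ∷ p) (suc i) p[i]≡false = ∣p[i]≔true∣ p i p[i]≡false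

∣p∣≢n⇒∃false : ∀ {n} (p : Subset n) → ∣ p ∣ ≢ n → ∃ λ i → lookup p i ≡ false
∣p∣≢n⇒∃false []          ∣p∣≢0 = contradiction refl ∣p∣≢0
∣p∣≢n⇒∃false (true ∷ p)  ∣p∣≢n with ∣p∣≢n⇒∃false p (λ eq → ∣p∣≢n (cong suc eq))
... | i , p[i]≡false = suc i , p[i]≡false
∣p∣≢n⇒∃false (false ∷ p) _ = zero , refl

CountsFilled : ∀ {t} → State t → Set
CountsFilled (S , c) = c ≡ ∣ S ∣

step-countsFilled : ∀ {t u} (b : Fin u → Fin t) (st : State t) a → CountsFilled st → CountsFilled (step b st a)
step-countsFilled b (S , c) a c≡∣S∣ with lookup S (b a) in eq
... | true  = c≡∣S∣
... | false = trans (cong suc c≡∣S∣) (sym (∣p[i]≔true∣ S (b a) eq))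

empty-after-step : ∀ {t u} (b : Fin u → Fin t) (st : State t) a j →
                   lookup (proj₁ (step b st a)) j ≡ false → lookup (proj₁ st) j ≡ false × b a ≢ j
empty-after-step b (S , c) a j empty with lookup S (b a) in eq
... | true  = empty , λ { refl → contradiction (trans (sym eq) empty) λ () }
... | false with b a F.≟ j
...   | yes refl = contradiction (trans (sym (lookup∘update (b a) S true)) empty) λ ()
...   | no ba≢j  = trans (sym (lookup∘update′ (ba≢j ∘ sym) S true)) empty , ba≢j

round : ∀ {t u} → Subset u → (Fin u → Fin t) → State t → State t
round A b st = foldl (step b) st (keys A)

afterRounds : ∀ {t u} → Subset u → List (Fin u → Fin t) → State t → State t
afterRounds A []       st = st
afterRounds A (b ∷ bs) st = afterRounds A bs (round A b st)

foldl-step-countsFilled : ∀ {t u} (b : Fin u → Fin t) as (st : State t) →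
                          CountsFilled st → CountsFilled (foldl (step b) st as)
foldl-step-countsFilled b []       st counted = counted
foldl-step-countsFilled b (a ∷ as) st counted = foldl-step-countsFilled b as (step b st a) (step-countsFilled b st a counted)

empty-after-foldl : ∀ {t u} (b : Fin u → Fin t) as (st : State t) j →
                    lookup (proj₁ (foldl (step b) st as)) j ≡ false →
                    lookup (proj₁ st) j ≡ false × (∀ {a} → a ∈ as → b a ≢ j)
empty-after-foldl b []       st j empty = empty , λ ()
empty-after-foldl b (a ∷ as) st j empty with empty-after-foldl b as (step b st a) j empty
... | empty′ , missed with empty-after-step b st a j empty′
...   | empty″ , ba≢j = empty″ , λ { (here refl) → ba≢j ; (there a∈as) → missed a∈as }

empty-after-rounds : ∀ {t u} (A : Subset u) bs (st : State t) j →
                     lookup (proj₁ (afterRounds A bs st)) j ≡ false → lookup (proj₁ st) j ≡ false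
empty-after-rounds A []       st j empty = empty
empty-after-rounds A (b ∷ bs) st j empty =
  proj₁ (empty-after-foldl b (keys A) st j (empty-after-rounds A bs (round A b st) j empty))

absent : Bool → ℕ
absent true  = 0
absent false = 1

emptyBuckets : ∀ {t} → Subset t → ℕ
emptyBuckets {t} S = sum (map (λ j → absent (lookup S j)) (allFin t))

pending : ∀ {t} → State t → ℕ
pending (S , _) = 1 ⊓ emptyBuckets S

absent-mono : ∀ {x y} → (x ≡ false → y ≡ false) → absent x ≤ absent y
absent-mono {true}  _     = z≤n
absent-mono {false} x⇒y rewrite x⇒y refl = ≤-refl

pending-afterRounds : ∀ {t u} (A : Subset u) bs (st : State t) → pending (afterRounds A bs st) ≤ pending st
pending-afterRounds {t} A bs st =
  ⊓-monoʳ-≤ 1 (sum-map-mono-≤ (allFin t) (λ j → absent-mono (empty-after-rounds A bs st j)))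

pending-unfinished : ∀ {t} (st : State t) → CountsFilled st → proj₂ st ≢ t → pending st ≡ 1
pending-unfinished {t} (S , c) c≡∣S∣ c≢t with ∣p∣≢n⇒∃false S (λ ∣S∣≡t → c≢t (trans c≡∣S∣ ∣S∣≡t))
... | j , S[j]≡false = m≤n⇒m⊓n≡m (≤-trans (≤-reflexive (cong absent (sym S[j]≡false)))
                                          (∈⇒≤sum-map (λ j → absent (lookup S j)) (∈-allFin j)))

pendingSum : ∀ {t u} → Subset u → List (Fin u → Fin t) → State t → ℕ
pendingSum A bs st = ∑[ r < length bs ] pending (afterRounds A (take (suc r) bs) st)

runRounds-∷ : ∀ {t u} (A : Subset u) b bs (st : State t) →
  runRounds A (b ∷ bs) st ≡ (∣ A ∣ + 1) + (if proj₂ (round A b st) ≡ᵇ t then 0 else runRounds A bs (round A b st))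
runRounds-∷ A b bs st = refl

runRounds≤ : ∀ {t u} (A : Subset u) bs (st : State t) → CountsFilled st →
             runRounds A bs st ≤ (∣ A ∣ + 1) * (1 + pendingSum A bs st)
runRounds≤ A []       st counted = z≤n
runRounds≤ {t} A (b ∷ bs) st counted rewrite runRounds-∷ A b bs st with proj₂ (round A b st) ≡ᵇ t in done
... | true  = ≤-trans (≤-reflexive (trans (+-identityʳ k) (sym (*-identityʳ k)))) (*-monoʳ-≤ k (m≤m+n 1 _))
  where k = ∣ A ∣ + 1
... | false = begin
  k + runRounds A bs st′                     ≤⟨ +-monoʳ-≤ k (runRounds≤ A bs st′ counted′) ⟩
  k + k * (1 + pendingSum A bs st′)          ≡⟨ *-suc k (1 + pendingSum A bs st′) ⟨
  k * (1 + (1 + pendingSum A bs st′))        ≡⟨ cong (λ p → k * (1 + (p + pendingSum A bs st′))) unfinished ⟨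
  k * (1 + (pending st′ + pendingSum A bs st′)) ∎
  where
  open ≤-Reasoning
  k = ∣ A ∣ + 1
  st′ = round A b st
  counted′ : CountsFilled st′
  counted′ = foldl-step-countsFilled b (keys A) st counted
  unfinished : pending st′ ≡ 1
  unfinished = pending-unfinished st′ counted′ (λ c≡t → subst T done (≡⇒≡ᵇ _ _ c≡t))

pendingSum-++ : ∀ {t u} (A : Subset u) xs ys (st : State t) →
  pendingSum A (xs ++ ys) st ≡ pendingSum A xs st + pendingSum A ys (afterRounds A xs st)
pendingSum-++ A []       ys st = refl
pendingSum-++ A (b ∷ xs) ys st = trans (cong (pending (round A b st) +_) (pendingSum-++ A xs ys (round A b st)))
                                       (sym (+-assoc (pending (round A b st)) _ _))

pendingSum≤ : ∀ {t u} (A : Subset u) bs (st : State t) → pendingSum A bs st ≤ length bs * pending st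
pendingSum≤ A []       st = z≤n
pendingSum≤ A (b ∷ bs) st = +-mono-≤ (pending-afterRounds A (b ∷ []) st)
  (≤-trans (pendingSum≤ A bs (round A b st)) (*-monoʳ-≤ (length bs) (pending-afterRounds A (b ∷ []) st)))

rows : ∀ {n t u} → Vec (Vec (Fin t) u) n → List (Fin u → Fin t)
rows o = map (λ row a → lookup row a) (toList o)

length-rows : ∀ {n t u} (o : Vec (Vec (Fin t) u) n) → length (rows o) ≡ n
length-rows o = trans (length-map _ (toList o)) (length-toList o)

initial : ∀ t → State t
initial t = replicate t false , 0

initial-countsFilled : ∀ t → CountsFilled (initial t)
initial-countsFilled zero    = refl
initial-countsFilled (suc t) = initial-countsFilled t

stateAfter : ∀ {t u} → Subset u → ℕ → Outcome t u → State t
stateAfter {t} A r o = afterRounds A (take r (rows o)) (initial t)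

runningTime≤ : ∀ t u (A : Subset u) (o : Outcome t u) →
  runningTime t u A o ≤ (t + 1) + (∣ A ∣ + 1) * (1 + ((∑[ r < t ] pending (stateAfter A (suc r) o))
                                                         + t * pending (stateAfter A t o)))
runningTime≤ t u A o = +-monoʳ-≤ (t + 1) (≤-trans (runRounds≤ A (buckets o) (initial t) (initial-countsFilled t))
  (*-monoʳ-≤ (∣ A ∣ + 1) (+-monoʳ-≤ 1 (begin
    pendingSum A (rows o ++ final) (initial t)                         ≡⟨ pendingSum-++ A (rows o) final (initial t) ⟩
    pendingSum A (rows o) (initial t) + pendingSum A final random      ≤⟨ +-monoʳ-≤ _ (pendingSum≤ A final random) ⟩
    pendingSum A (rows o) (initial t) + length final * pending random  ≡⟨ cong₂ _+_ random-rounds final-rounds ⟩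
    (∑[ r < t ] pending (stateAfter A (suc r) o)) + t * pending (stateAfter A t o) ∎))))
  where
  open ≤-Reasoning
  final : List (Fin u → Fin t)
  final = map (λ j _ → j) (allFin t)
  random = afterRounds A (rows o) (initial t)
  random-rounds : pendingSum A (rows o) (initial t) ≡ ∑[ r < t ] pending (stateAfter A (suc r) o)
  random-rounds = cong (λ n → ∑[ r < n ] pending (stateAfter A (suc r) o)) (length-rows o)
  final-rounds : length final * pending random ≡ t * pending (stateAfter A t o)
  final-rounds = cong₂ (λ n bs → n * pending (afterRounds A bs (initial t)))
                       (trans (length-map _ (allFin t)) (length-allFin t))
                       (sym (take-all t (rows o) (≤-reflexive (length-rows o))))

-- Counting outcomes

sum-map-allVecs-suc : ∀ {R : Set} n (xs : List R) (f : Vec R (suc n) → ℕ) →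
  sum (map f (allVecs (suc n) xs)) ≡ sum (map (λ x → sum (map (λ v → f (x ∷ v)) (allVecs n xs))) xs)
sum-map-allVecs-suc n xs f = trans (sum-map-concatMap f (λ x → map (x ∷_) (allVecs n xs)) xs)
  (sum-map-cong xs (λ x → cong sum (sym (map-∘ (allVecs n xs)))))

length-allVecs : ∀ {R : Set} n (xs : List R) → length (allVecs n xs) ≡ length xs ^ n
length-allVecs zero    xs = refl
length-allVecs (suc n) xs = begin
  length (allVecs (suc n) xs)                                      ≡⟨ length≡sum-map-1 (allVecs (suc n) xs) ⟩
  sum (map (λ _ → 1) (allVecs (suc n) xs))                         ≡⟨ sum-map-allVecs-suc n xs _ ⟩
  sum (map (λ _ → sum (map (λ _ → 1) (allVecs n xs))) xs)
    ≡⟨ sum-map-cong xs (λ _ → sym (length≡sum-map-1 (allVecs n xs))) ⟩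
  sum (map (λ _ → length (allVecs n xs)) xs)                       ≡⟨ sum-map-cong xs (λ _ → length-allVecs n xs) ⟩
  sum (map (λ _ → length xs ^ n) xs)                               ≡⟨ sum-map-const (length xs ^ n) xs ⟩
  length xs ^ n * length xs                                        ≡⟨ *-comm (length xs ^ n) (length xs) ⟩
  length xs ^ suc n                                                ∎
  where open ≡-Reasoning

prefixProduct : ∀ {R : Set} {n} → (R → ℕ) → ℕ → Vec R n → ℕ
prefixProduct g zero    v       = 1
prefixProduct g (suc r) []      = 1
prefixProduct g (suc r) (x ∷ v) = g x * prefixProduct g r v

sum-map-prefixProduct : ∀ {R : Set} (g : R → ℕ) r s (xs : List R) →
  sum (map (prefixProduct g r) (allVecs (r + s) xs)) ≡ sum (map g xs) ^ r * length xs ^ s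
sum-map-prefixProduct g zero    s xs =
  trans (sym (length≡sum-map-1 (allVecs s xs))) (trans (length-allVecs s xs) (sym (*-identityˡ _)))
sum-map-prefixProduct g (suc r) s xs = begin
  sum (map (prefixProduct g (suc r)) (allVecs (suc (r + s)) xs))       ≡⟨ sum-map-allVecs-suc (r + s) xs _ ⟩
  sum (map (λ x → sum (map (λ v → g x * prefixProduct g r v) (allVecs (r + s) xs))) xs)
    ≡⟨ sum-map-cong xs (λ x → sym (*-distribˡ-sum-map (g x) (prefixProduct g r) (allVecs (r + s) xs))) ⟩
  sum (map (λ x → g x * sum (map (prefixProduct g r) (allVecs (r + s) xs))) xs)
    ≡⟨ sym (*-distribʳ-sum-map _ g xs) ⟩
  sum (map g xs) * sum (map (prefixProduct g r) (allVecs (r + s) xs))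
    ≡⟨ cong (sum (map g xs) *_) (sum-map-prefixProduct g r s xs) ⟩
  sum (map g xs) * (sum (map g xs) ^ r * length xs ^ s)                ≡⟨ *-assoc (sum (map g xs)) _ _ ⟨
  sum (map g xs) ^ suc r * length xs ^ s                               ∎
  where open ≡-Reasoning

differs : ∀ {n} → Fin n → Fin n → ℕ
differs zero    zero    = 0
differs zero    (suc _) = 1
differs (suc _) zero    = 1
differs (suc x) (suc y) = differs x y

≢⇒1≤differs : ∀ {n} (x y : Fin n) → x ≢ y → 1 ≤ differs x y
≢⇒1≤differs zero    zero    x≢y = contradiction refl x≢y
≢⇒1≤differs zero    (suc _) _   = ≤-refl
≢⇒1≤differs (suc _) zero    _   = ≤-refl
≢⇒1≤differs (suc x) (suc y) x≢y = ≢⇒1≤differs x y (λ x≡y → x≢y (cong suc x≡y))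

sum-tabulate-1 : ∀ n → sum (tabulate {n = n} (λ _ → 1)) ≡ n
sum-tabulate-1 zero    = refl
sum-tabulate-1 (suc n) = cong suc (sum-tabulate-1 n)

sum-differs : ∀ n (j : Fin (suc n)) → sum (map (λ y → differs y j) (allFin (suc n))) ≡ n
sum-differs n j = trans (cong sum (map-tabulate (λ i → i) (λ y → differs y j))) (count n j)
  where
  count : ∀ n (j : Fin (suc n)) → sum (tabulate (λ y → differs y j)) ≡ n
  count zero    zero    = refl
  count (suc n) zero    = sum-tabulate-1 (suc n)
  count (suc n) (suc j) = cong suc (count n j)

avoids : ∀ {t u} → Subset u → Fin t → Vec (Fin t) u → ℕ
avoids []          j []       = 1
avoids (true ∷ A)  j (y ∷ ys) = differs y j * avoids A j ys
avoids (false ∷ A) j (y ∷ ys) = avoids A j ys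

1≤avoids : ∀ {t u} (A : Subset u) (j : Fin t) (row : Vec (Fin t) u) →
           (∀ a → lookup A a ≡ true → lookup row a ≢ j) → 1 ≤ avoids A j row
1≤avoids []          j []        _      = ≤-refl
1≤avoids (true ∷ A)  j (y ∷ row) missed =
  *-mono-≤ (≢⇒1≤differs y j (missed zero refl)) (1≤avoids A j row (λ a → missed (suc a)))
1≤avoids (false ∷ A) j (y ∷ row) missed = 1≤avoids A j row (λ a → missed (suc a))

-- A uniform row misses bucket j on all of A with probability (1 − 1/t)^∣A∣.
sum-map-avoids : ∀ P {u} (A : Subset u) (j : Fin (suc P)) →
  sum (map (avoids A j) (allVecs u (allFin (suc P)))) * suc P ^ ∣ A ∣ ≡ suc P ^ u * P ^ ∣ A ∣
sum-map-avoids P []          j = refl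
sum-map-avoids P {suc u} (true ∷ A) j = begin
  sum (map (avoids (true ∷ A) j) (allVecs (suc u) ys)) * (t * t ^ k)
    ≡⟨ cong (_* (t * t ^ k)) (sum-map-allVecs-suc u ys _) ⟩
  sum (map (λ y → sum (map (λ v → differs y j * avoids A j v) (allVecs u ys))) ys) * (t * t ^ k)
    ≡⟨ cong (_* (t * t ^ k)) (sum-map-cong ys (λ y →
         sym (*-distribˡ-sum-map (differs y j) (avoids A j) (allVecs u ys)))) ⟩
  sum (map (λ y → differs y j * G) ys) * (t * t ^ k)
    ≡⟨ cong (_* (t * t ^ k)) (trans (sym (*-distribʳ-sum-map G (λ y → differs y j) ys))
                                     (cong (_* G) (sum-differs P j))) ⟩
  P * G * (t * t ^ k)        ≡⟨ regroup P G t (t ^ k) ⟩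
  t * (P * (G * t ^ k))      ≡⟨ cong (λ z → t * (P * z)) (sum-map-avoids P A j) ⟩
  t * (P * (t ^ u * P ^ k))  ≡⟨ regroup′ t P (t ^ u) (P ^ k) ⟩
  t * t ^ u * (P * P ^ k)    ∎
  where
  open ≡-Reasoning
  t = suc P
  k = ∣ A ∣
  ys = allFin t
  G = sum (map (avoids A j) (allVecs u ys))
  regroup : ∀ P G t x → P * G * (t * x) ≡ t * (P * (G * x))
  regroup = solve-∀
  regroup′ : ∀ t P a b → t * (P * (a * b)) ≡ t * a * (P * b)
  regroup′ = solve-∀
sum-map-avoids P {suc u} (false ∷ A) j = begin
  sum (map (avoids (false ∷ A) j) (allVecs (suc u) ys)) * t ^ k
    ≡⟨ cong (_* t ^ k) (sum-map-allVecs-suc u ys _) ⟩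
  sum (map (λ _ → G) ys) * t ^ k        ≡⟨ cong (_* t ^ k) (trans (sum-map-const G ys) (cong (G *_) (length-allFin t))) ⟩
  G * t * t ^ k                         ≡⟨ regroup G t (t ^ k) ⟩
  t * (G * t ^ k)                       ≡⟨ cong (t *_) (sum-map-avoids P A j) ⟩
  t * (t ^ u * P ^ k)                   ≡⟨ *-assoc t (t ^ u) (P ^ k) ⟨
  t * t ^ u * P ^ k                     ∎
  where
  open ≡-Reasoning
  t = suc P
  k = ∣ A ∣
  ys = allFin t
  G = sum (map (avoids A j) (allVecs u ys))
  regroup : ∀ G t x → G * t * x ≡ t * (G * x)
  regroup = solve-∀

∈keys : ∀ {u} (A : Subset u) {a} → lookup A a ≡ true → a ∈ keys A
∈keys A {a} A[a]≡true = ∈-filter⁺ (λ x → T? (lookup A x)) (∈-allFin a) (subst T (sym A[a]≡true) tt)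

empty⇒1≤prefixProduct-avoids : ∀ {t u n} (A : Subset u) (j : Fin t) r (v : Vec (Vec (Fin t) u) n) (st : State t) →
  lookup (proj₁ (afterRounds A (take r (rows v)) st)) j ≡ false → 1 ≤ prefixProduct (avoids A j) r v
empty⇒1≤prefixProduct-avoids A j zero    v        st _     = ≤-refl
empty⇒1≤prefixProduct-avoids A j (suc r) []       st _     = ≤-refl
empty⇒1≤prefixProduct-avoids A j (suc r) (row ∷ v) st empty =
  *-mono-≤ (1≤avoids A j row (λ a A[a] → missed (∈keys A A[a])))
           (empty⇒1≤prefixProduct-avoids A j r v (round A b st) empty)
  where
  b = λ a → lookup row a
  missed : ∀ {a} → a ∈ keys A → b a ≢ j
  missed = proj₂ (empty-after-foldl b (keys A) st j
                   (empty-after-rounds A (take r (rows v)) (round A b st) j empty))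

module Expectation (P u : ℕ) (A : Subset u) where

  t = suc P
  k = ∣ A ∣
  R = allVecs u (allFin t)
  O = outcomes t u
  N = length O

  Y : ℕ → ℕ
  Y r = sum (map (λ o → pending (stateAfter A r o)) O)

  Y≤N : ∀ r → Y r ≤ N
  Y≤N r = ≤-trans (sum-map-mono-≤ O (λ _ → m⊓n≤m 1 _)) (≤-reflexive (sym (length≡sum-map-1 O)))

  length-R : length R ≡ t ^ u
  length-R = trans (length-allVecs u (allFin t)) (cong (_^ u) (length-allFin t))

  ^[r*k] : ∀ a r → a ^ (r * k) ≡ (a ^ k) ^ r
  ^[r*k] a r = trans (cong (a ^_) (*-comm r k)) (sym (^-*-assoc a k r))

  sum-avoiding-outcomes : ∀ j r s → r + s ≡ t →
    sum (map (prefixProduct (avoids A j) r) O) * t ^ (r * k) ≡ N * P ^ (r * k)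
  sum-avoiding-outcomes j r s r+s≡t = begin
    sum (map (prefixProduct (avoids A j) r) O) * t ^ (r * k)
      ≡⟨ cong (_* t ^ (r * k)) (cong (λ n → sum (map (prefixProduct {n = n} (avoids A j) r) (allVecs n R))) r+s≡t) ⟨
    sum (map (prefixProduct (avoids A j) r) (allVecs (r + s) R)) * t ^ (r * k)
      ≡⟨ cong (_* t ^ (r * k)) (sum-map-prefixProduct (avoids A j) r s R) ⟩
    G ^ r * M ^ s * t ^ (r * k)        ≡⟨ cong (G ^ r * M ^ s *_) (^[r*k] t r) ⟩
    G ^ r * M ^ s * (t ^ k) ^ r        ≡⟨ regroup (G ^ r) (M ^ s) ((t ^ k) ^ r) ⟩
    G ^ r * (t ^ k) ^ r * M ^ s        ≡⟨ cong (_* M ^ s) (^-distribʳ-* G (t ^ k) r) ⟨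
    (G * t ^ k) ^ r * M ^ s            ≡⟨ cong (λ z → z ^ r * M ^ s) G*t^k≡M*P^k ⟩
    (M * P ^ k) ^ r * M ^ s            ≡⟨ cong (_* M ^ s) (^-distribʳ-* M (P ^ k) r) ⟩
    M ^ r * (P ^ k) ^ r * M ^ s        ≡⟨ regroup (M ^ r) ((P ^ k) ^ r) (M ^ s) ⟩
    M ^ r * M ^ s * (P ^ k) ^ r        ≡⟨ cong₂ _*_ (^-distribˡ-+-* M r s) (^[r*k] P r) ⟨
    M ^ (r + s) * P ^ (r * k)          ≡⟨ cong (λ n → M ^ n * P ^ (r * k)) r+s≡t ⟩
    M ^ t * P ^ (r * k)                ≡⟨ cong (_* P ^ (r * k)) (length-allVecs t R) ⟨
    N * P ^ (r * k)                    ∎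
    where
    open ≡-Reasoning
    G = sum (map (avoids A j) R)
    M = length R
    G*t^k≡M*P^k : G * t ^ k ≡ M * P ^ k
    G*t^k≡M*P^k = trans (sum-map-avoids P A j) (cong (_* P ^ k) (sym length-R))
    regroup : ∀ a b c → a * b * c ≡ a * c * b
    regroup = solve-∀

  pending≤∑avoiding : ∀ r o →
    pending (stateAfter A r o) ≤ sum (map (λ j → prefixProduct (avoids A j) r o) (allFin t))
  pending≤∑avoiding r o = ≤-trans (m⊓n≤n 1 _) (sum-map-mono-≤ (allFin t) absent≤)
    where
    absent≤ : ∀ j → absent (lookup (proj₁ (stateAfter A r o)) j) ≤ prefixProduct (avoids A j) r o
    absent≤ j with lookup (proj₁ (stateAfter A r o)) j in empty
    ... | true  = z≤n
    ... | false = empty⇒1≤prefixProduct-avoids A j r o (initial t) empty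

  Y-decay : ∀ r → r ≤ t → Y r * t ^ (r * k) ≤ t * N * P ^ (r * k)
  Y-decay r r≤t with m≤n⇒∃[o]m+o≡n r≤t
  ... | s , r+s≡t = begin
    Y r * c
      ≤⟨ *-monoˡ-≤ c (sum-map-mono-≤ O (pending≤∑avoiding r)) ⟩
    sum (map (λ o → sum (map (λ j → avoiding j o) (allFin t))) O) * c
      ≡⟨ cong (_* c) (sum-map-comm (λ o j → avoiding j o) O (allFin t)) ⟩
    sum (map (λ j → sum (map (avoiding j) O)) (allFin t)) * c
      ≡⟨ *-distribʳ-sum-map c (λ j → sum (map (avoiding j) O)) (allFin t) ⟩
    sum (map (λ j → sum (map (avoiding j) O) * c) (allFin t))
      ≡⟨ sum-map-cong (allFin t) (λ j → sum-avoiding-outcomes j r s r+s≡t) ⟩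
    sum (map (λ _ → N * P ^ (r * k)) (allFin t)) ≡⟨ sum-map-const _ (allFin t) ⟩
    N * P ^ (r * k) * length (allFin t)          ≡⟨ cong (N * P ^ (r * k) *_) (length-allFin t) ⟩
    N * P ^ (r * k) * t                          ≡⟨ regroup N (P ^ (r * k)) t ⟩
    t * N * P ^ (r * k)                          ∎
    where
    open ≤-Reasoning
    c = t ^ (r * k)
    avoiding : Fin t → Outcome t u → ℕ
    avoiding j = prefixProduct (avoids A j) r
    regroup : ∀ a b c → a * b * c ≡ c * a * b
    regroup = solve-∀

expected-runningTime≤ : ∀ P u (A : Subset u) →
  sum (map (runningTime (suc P) u A) (outcomes (suc P) u))
    ≤ 6 * (suc P * ⌈log₂ suc P ⌉ + ∣ A ∣ + 1) * length (outcomes (suc P) u)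
expected-runningTime≤ P u A = begin
  sum (map (runningTime t u A) O)                               ≤⟨ sum-map-mono-≤ O (runningTime≤ t u A) ⟩
  sum (map (λ o → (t + 1) + (k + 1) * (1 + (f o + t * g o))) O) ≡⟨ linearity ⟩
  (t + 1) * N + (k + 1) * (N + ∑Y + t * Y t)                     ≤⟨ rounds-bound ⟩
  6 * (t * ⌈log₂ t ⌉ + k + 1) * N                                ∎
  where
  open ≤-Reasoning
  open Expectation P u A
  open PendingRounds P ⌈log₂ t ⌉ k N Y (n≤2^⌈log₂n⌉ t) Y≤N Y-decay
  f g : Outcome t u → ℕ
  f o = ∑[ r < t ] pending (stateAfter A (suc r) o)
  g o = pending (stateAfter A t o)
  linearity : sum (map (λ o → (t + 1) + (k + 1) * (1 + (f o + t * g o))) O)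
              ≡ (t + 1) * N + (k + 1) * (N + ∑Y + t * Y t)
  linearity = begin-equality
    sum (map (λ o → (t + 1) + (k + 1) * (1 + (f o + t * g o))) O)
      ≡⟨ sum-map-+ (λ _ → t + 1) (λ o → (k + 1) * (1 + (f o + t * g o))) O ⟩
    sum (map (λ _ → t + 1) O) + sum (map (λ o → (k + 1) * (1 + (f o + t * g o))) O)
      ≡⟨ cong₂ _+_ (sum-map-const (t + 1) O) (sym (*-distribˡ-sum-map (k + 1) (λ o → 1 + (f o + t * g o)) O)) ⟩
    (t + 1) * N + (k + 1) * sum (map (λ o → 1 + (f o + t * g o)) O)
      ≡⟨ cong (λ z → (t + 1) * N + (k + 1) * z) (begin-equality
           sum (map (λ o → 1 + (f o + t * g o)) O)
             ≡⟨ sum-map-+ (λ _ → 1) (λ o → f o + t * g o) O ⟩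
           sum (map (λ _ → 1) O) + sum (map (λ o → f o + t * g o) O)
             ≡⟨ cong₂ _+_ (sym (length≡sum-map-1 O)) (sum-map-+ f (λ o → t * g o) O) ⟩
           N + (sum (map f O) + sum (map (λ o → t * g o) O))
             ≡⟨ cong (N +_) (cong₂ _+_ (sum-map-∑< t (λ r o → pending (stateAfter A (suc r) o)) O)
                                       (sym (*-distribˡ-sum-map t g O))) ⟩
           N + (∑Y + t * Y t)
             ≡⟨ +-assoc N ∑Y (t * Y t) ⟨
           N + ∑Y + t * Y t ∎) ⟩
    (t + 1) * N + (k + 1) * (N + ∑Y + t * Y t) ∎

lemma2 : ∃[ C ] ((t u : ℕ) → 1 ≤ t → (A : Subset u) →
           sum (map (runningTime t u A) (outcomes t u))
             ≤ C * (t * ⌈log₂ t ⌉ + ∣ A ∣ + 1) * length (outcomes t u))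
lemma2 = 6 , λ { zero u () A ; (suc P) u _ A → expected-runningTime≤ P u A }
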